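{- Let $\eta\ge1$ and $\zeta\ge\max(\eta+\delta,\alpha)$ be integers, let $G$ satisfy conditions (i)–(v), and let $\mathcal{T}$ be a 1-cleaned $(\zeta,\eta)$-template array in $G$ with sequence $(Y_i,H_i)$, $1\le i\le n$. Then for each $v\in V(\mathcal{T})$ there are at most $2\delta$ values of $i\in\{1,\dots,n\}$ such that $v$ has a neighbour in $Y_i$.
   Context: Fixed parameters: integers $\tau\ge0$, $\alpha\ge1$, $\delta\ge1$, $\beta\ge2$ and a non-decreasing $\theta:\mathbb{N}\to\mathbb{N}$. Graphs are finite and simple; $\chi(X)=\chi(G[X])$. A $(k,\delta)$-broom is obtained from a $k$-edge path with ends $a,b$ by adding $\delta$ leaves adjacent to $b$ ($a$ is the handle); $T(\delta)$ is obtained from $\delta$ disjoint $(1,\delta)$-brooms and $\delta$ disjoint $(2,\delta)$-brooms by identifying their handles; $H$-free means no induced subgraph isomorphic to $H$. $\chi^2(G)=\max_v\chi(N^2[v])$, $N^2[v]$ the vertices at distance $\le2$ from $v$. $X\subseteq V(G)$ is matching-covered if each $x\in X$ has a neighbour $y\notin X$ adjacent to no other vertex of $X$. An $(a,b)$-core is a set of $ab$ vertices partitioned into $b$ stable sets (parts) of size $a$ with all edges between distinct parts. Conditions: (i) $G$ is $T(\delta)$-free; (ii) $\chi^2(G)\le\tau$; (iii) every matching-covered set has chromatic number $\le\tau$; (iv) for all $a\ge1$, if $\chi(G)>\theta(a)$ then $G$ has an $(a,\beta)$-core; (v) $G$ has no $(\alpha,\beta+1)$-core. Templates: let $Y$ be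 a $(\zeta,\beta)$-core. $v\in V(G)\setminus Y$ is dense to $Y$ if it has at least $\alpha$ neighbours in each part of $Y$. $v$ is $\eta$-mixed on $Y$ if $v$ is not dense to $Y$ and has at least $\eta$ neighbours in some part of $Y$. A $(\zeta,\eta)$-template is $(Y,H)$ with $Y\subseteq H\subseteq V(G)$ and every vertex of $H$ $\eta$-mixed on $Y$. A $(\zeta,\eta)$-template sequence is $(Y_i,H_i)$, $1\le i\le n$, of templates with, for $i<j$: $H_i\cap H_j=\emptyset$, no edge between $H_i$ and $Y_j$, no vertex of $H_j$ $\eta$-mixed on $Y_i$. A $(\zeta,\eta)$-template array $\mathcal{T}$ is such a sequence plus $U(\mathcal{T})\subseteq V(G)$ whose vertices lie in no $H_i$, are $\eta$-mixed on no $Y_i$, and have a neighbour in $\bigcup_iH_i$. $H(\mathcal{T})=\bigcup_iH_i$, $V(\mathcal{T})=H(\mathcal{T})\cup U(\mathcal{T})$. $\mathcal{T}$ is 1-cleaned if for each $i$ no vertex of $V(\mathcal{T})$ is dense to $Y_i$. -}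

module Defs where

open import Data.Nat using (ℕ; _≤_; _+_; _*_; suc)
open import Data.Fin using (Fin) renaming (_<_ to _<ᶠ_)
open import Data.Fin.Subset using (Subset; ∣_∣; _∈_)
open import Data.Bool using (Bool; true; false)
open import Data.Vec using (tabulate)
open import Data.Product using (Σ; ∃; ∃-syntax; _×_)
open import Data.Sum using (_⊎_)
open import Relation.Binary.PropositionalEquality using (_≡_; _≢_)
open import Relation.Nullary using (¬_)

record Graph : Set where
  field
    N     : ℕ
    adj   : Fin N → Fin N → Bool
    sym   : ∀ u v → adj u v ≡ adj v u
    irref : ∀ v → adj v v ≡ false

module _ (G : Graph) where
  open Graph G

  V : Set
  V = Fin N

  VSet : Set₁
  VSet = V → Set

  E : V → V → Set
  E u v = adj u v ≡ true

  ColourableOn : VSet → ℕ → Set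
  ColourableOn X k = Σ (V → Fin k) λ c →
    ∀ x y → X x → X y → E x y → c x ≢ c y

  AllV : VSet
  AllV _ = ⊤'
    where open import Data.Unit using () renaming (⊤ to ⊤')

  N² : V → VSet
  N² v u = (u ≡ v) ⊎ E v u ⊎ (∃[ w ] (E v w × E w u))

  Chi2Le : ℕ → Set
  Chi2Le τ = ∀ v → ColourableOn (N² v) τ

  MatchingCovered : VSet → Set
  MatchingCovered X = ∀ x → X x →
    ∃[ y ] (¬ X y × E x y × (∀ x' → X x' → E x' y → x' ≡ x))

  -- (a,b)-cores: vertex part j, element k of that part is (pt j k).
  record Core (a b : ℕ) : Set where
    field
      pt       : Fin b → Fin a → V
      inj      : ∀ j k j' k' → pt j k ≡ pt j' k' → (j ≡ j') × (k ≡ k')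
      stable   : ∀ j k k' → ¬ E (pt j k) (pt j k')
      complete : ∀ j j' k k' → j ≢ j' → E (pt j k) (pt j' k')

  HasCore : ℕ → ℕ → Set
  HasCore a b = Core a b

  InCore : ∀ {a b} → Core a b → VSet
  InCore Y v = ∃[ j ] ∃[ k ] (Core.pt Y j k ≡ v)

  nbrsInPart : ∀ {a b} → Core a b → V → Fin b → ℕ
  nbrsInPart Y v j = ∣ tabulate (λ k → adj v (Core.pt Y j k)) ∣

  HasNbrIn : ∀ {a b} → Core a b → V → Set
  HasNbrIn Y v = ∃[ j ] ∃[ k ] E v (Core.pt Y j k)

  -- T(δ): a handle (root); δ (1,δ)-brooms root–b1 j with leaves l1 j k;
  -- δ (2,δ)-brooms root–c2 j–b2 j with leaves l2 j k.
  data TV (δ : ℕ) : Set where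
    root : TV δ
    b1   : Fin δ → TV δ
    l1   : Fin δ → Fin δ → TV δ
    c2   : Fin δ → TV δ
    b2   : Fin δ → TV δ
    l2   : Fin δ → Fin δ → TV δ

  data TE0 {δ : ℕ} : TV δ → TV δ → Set where
    e-rb1 : ∀ j → TE0 root (b1 j)
    e-b1l : ∀ j k → TE0 (b1 j) (l1 j k)
    e-rc2 : ∀ j → TE0 root (c2 j)
    e-c2b : ∀ j → TE0 (c2 j) (b2 j)
    e-b2l : ∀ j k → TE0 (b2 j) (l2 j k)

  TE : ∀ {δ} → TV δ → TV δ → Set
  TE x y = TE0 x y ⊎ TE0 y x

  HasInducedT : ℕ → Set
  HasInducedT δ = Σ (TV δ → V) λ f →
    (∀ x y → f x ≡ f y → x ≡ y) ×
    (∀ x y → (E (f x) (f y) → TE x y) × (TE x y → E (f x) (f y)))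

  record Conditions (τ α δ β : ℕ) (θ : ℕ → ℕ) : Set₁ where
    field
      c1 : ¬ HasInducedT δ
      c2' : Chi2Le τ
      c3 : ∀ X → MatchingCovered X → ColourableOn X τ
      c4 : ∀ a → 1 ≤ a → ¬ ColourableOn AllV (θ a) → HasCore a β
      c5 : ¬ HasCore α (suc β)

  module _ (α : ℕ) where
    Dense : ∀ {ζ β} → V → Core ζ β → Set
    Dense v Y = ¬ InCore Y v × (∀ j → α ≤ nbrsInPart Y v j)

    Mixed : ∀ {ζ β} → ℕ → V → Core ζ β → Set
    Mixed η v Y = ¬ Dense v Y × (∃[ j ] (η ≤ nbrsInPart Y v j))

    record TemplateArray (ζ β η : ℕ) : Set₁ where
      field
        n   : ℕ
        Y   : Fin n → Core ζ β
        H   : Fin n → VSet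
        Y⊆H   : ∀ i j k → H i (Core.pt (Y i) j k)
        Hmix  : ∀ i x → H i x → Mixed η x (Y i)
        disj   : ∀ i j → i <ᶠ j → ∀ x → H i x → ¬ H j x
        noEdge : ∀ i j → i <ᶠ j → ∀ x y → H i x → InCore (Y j) y → ¬ E x y
        noMix  : ∀ i j → i <ᶠ j → ∀ x → H j x → ¬ Mixed η x (Y i)
        U      : VSet
        U∉H    : ∀ u → U u → ∀ i → ¬ H i u
        UnoMix : ∀ u → U u → ∀ i → ¬ Mixed η u (Y i)
        Unbr   : ∀ u → U u → ∃[ i ] ∃[ x ] (H i x × E u x)

      VT : VSet
      VT v = (∃[ i ] H i v) ⊎ U v

      OneCleaned : Set
      OneCleaned = ∀ i v → VT v → ¬ Dense v (Y i)

-- Suppose v ∈ V(𝒯) has neighbours in the cores Y_i of 2δ + 1 templates. At most one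
-- of these templates contains v; discard it. For each of the other 2δ cores, the
-- sequence and array axioms show that v lies outside Y_i and is not η-mixed on it,
-- and 1-cleanedness shows that v is not dense to it, so v has fewer than η ≤ ζ − δ
-- neighbours in every part: each part contains δ non-neighbours of v. Distinct cores
-- are disjoint and anticomplete. Hanging a (1,δ)-broom from a neighbour of v in each
-- of δ cores, and a (2,δ)-broom from a neighbour of v in each of the other δ, now
-- gives an induced T(δ) rooted at v, which condition (i) forbids.
module Submission where

open import Defs
open import Data.Nat using (ℕ; zero; suc; _≤_; _<_; _+_; _*_; _⊔_; s≤s; _≤?_)
open import Data.Nat.Properties using (≤-trans; <⇒≤; ≰⇒>; m≤m⊔n; +-comm; +-identityʳ; +-monoˡ-≤; m+n≤o⇒m≤o∸n)
open import Data.Fin using (Fin; zero; suc; punchIn; join; splitAt; _≟_)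
open import Data.Fin.Properties using (suc-injective; punchIn-injective; punchInᵢ≢i; any?; <-cmp; splitAt-join)
open import Data.Fin.Subset using (Subset; inside; outside; ∁; ∣_∣; _∈_)
open import Data.Fin.Subset.Properties using (∣∁p∣≡n∸∣p∣; x∈∁p⇒x∉p)
open import Data.Vec using (_∷_; tabulate; here; there)
open import Data.Vec.Properties using (lookup⇒[]=; lookup∘tabulate)
open import Data.Maybe using (Maybe; just; nothing)
open import Data.Maybe.Properties using (just-injective)
open import Data.Product using (Σ; _×_; _,_; proj₁; proj₂)
open import Data.Sum using (_⊎_; inj₁; inj₂; swap)
open import Data.Empty using (⊥-elim)
open import Function using (_∘_)
open import Function.Definitions using (Injective)
open import Relation.Nullary using (¬_; yes; no)
open import Relation.Binary using (tri<; tri≈; tri>)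
open import Relation.Binary.PropositionalEquality

Selection : ∀ {n} → Set → (Fin n → Set) → Set
Selection {n} A P = Σ (A → Fin n) λ f → Injective _≡_ _≡_ f × (∀ x → P (f x))

select : ∀ {n m} (p : Subset n) → m ≤ ∣ p ∣ → Selection (Fin m) (_∈ p)
select {m = zero} _ _ = (λ ()) , (λ { {()} }) , (λ ())
select {m = suc m} (outside ∷ p) m<∣p∣ with f , f-inj , f∈p ← select p m<∣p∣ =
  suc ∘ f , f-inj ∘ suc-injective , there ∘ f∈p
select {m = suc m} (inside ∷ p) (s≤s m≤∣p∣) with f , f-inj , f∈p ← select p m≤∣p∣ =
  g , g-inj , g∈p
  where
  g : Fin (suc m) → Fin _
  g zero    = zero
  g (suc x) = suc (f x)

  g-inj : Injective _≡_ _≡_ g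
  g-inj {zero}  {zero}  _ = refl
  g-inj {suc x} {suc y} e = cong suc (f-inj (suc-injective e))

  g∈p : ∀ x → g x ∈ (inside ∷ p)
  g∈p zero    = here
  g∈p (suc x) = there (f∈p x)

selection-map : ∀ {n A} {P Q : Fin n → Set} → (∀ {i} → P i → Q i) → Selection A P → Selection A Q
selection-map P⇒Q (f , f-inj , Pf) = f , f-inj , P⇒Q ∘ Pf

selection-reindex : ∀ {n A B} {P : Fin n → Set} (g : B → A) → Injective _≡_ _≡_ g →
                    Selection A P → Selection B P
selection-reindex g g-inj (f , f-inj , Pf) = f ∘ g , g-inj ∘ f-inj , Pf ∘ g

selection-avoid : ∀ {n m} {P : Fin n → Set} → Selection (Fin (suc m)) P → (k : Maybe (Fin n)) →
                  Selection (Fin m) (λ i → P i × just i ≢ k)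
selection-avoid (f , f-inj , Pf) nothing = f ∘ suc , suc-injective ∘ f-inj , λ x → Pf (suc x) , λ ()
selection-avoid (f , f-inj , Pf) (just k) with any? (λ x → f x ≟ k)
... | yes (x , fx≡k) =
  f ∘ punchIn x , punchIn-injective x _ _ ∘ f-inj ,
  λ y → Pf _ , λ e → punchInᵢ≢i x y (f-inj (trans (just-injective e) (sym fx≡k)))
... | no ∄x = f ∘ suc , suc-injective ∘ f-inj , λ y → Pf _ , λ e → ∄x (suc y , just-injective e)

join-injective : ∀ m n → Injective _≡_ _≡_ (join m n)
join-injective m n {x} {y} e = begin
  x                      ≡⟨ sym (splitAt-join m n x) ⟩
  splitAt m (join m n x) ≡⟨ cong (splitAt m) e ⟩
  splitAt m (join m n y) ≡⟨ splitAt-join m n y ⟩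
  y                      ∎
  where open ≡-Reasoning

IsInducedEmbedding : ∀ {A B : Set} → (A → A → Set) → (B → B → Set) → (A → B) → Set
IsInducedEmbedding R S f =
  (∀ x y → f x ≡ f y → x ≡ y) × (∀ x y → (S (f x) (f y) → R x y) × (R x y → S (f x) (f y)))

isInducedEmbedding-∘ : ∀ {A B C : Set} {R : A → A → Set} {S : B → B → Set} {U : C → C → Set}
                       {f : A → B} {g : B → C} →
                       IsInducedEmbedding R S f → IsInducedEmbedding S U g → IsInducedEmbedding R U (g ∘ f)
isInducedEmbedding-∘ {f = f} (f-inj , f-emb) (g-inj , g-emb) =
  (λ x y → f-inj x y ∘ g-inj (f x) (f y)) ,
  λ x y → proj₁ (f-emb x y) ∘ proj₁ (g-emb (f x) (f y)) , proj₂ (g-emb (f x) (f y)) ∘ proj₂ (f-emb x y)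

retract⇒isInducedEmbedding : ∀ {A B : Set} {R : A → A → Set} {S : B → B → Set} (h : A → B) (r : B → A) →
                             (∀ {x y} → R x y → S (h x) (h y)) → (∀ {b b'} → S b b' → R (r b) (r b')) →
                             (∀ x → r (h x) ≡ x) → IsInducedEmbedding R S h
retract⇒isInducedEmbedding {R = R} h r h-hom r-hom r∘h =
  (λ x y e → trans (sym (r∘h x)) (trans (cong r e) (r∘h y))) ,
  λ x y → subst₂ R (r∘h x) (r∘h y) ∘ r-hom , h-hom

-- The skeleton on Node I d: an apex, and for each r : I a complete bipartite graph
-- between {hook, near 0, …} and {far 0, …}, whose hook is joined to the apex.
-- For I = Broom δ and d = δ, T(δ) is a retract of the skeleton.
data Slot (d : ℕ) : Set where
  hook      : Slot d
  near far  : Fin d → Slot d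

data Node (I : Set) (d : ℕ) : Set where
  apex : Node I d
  node : I → Slot d → Node I d

data Linked {I : Set} {d : ℕ} : Node I d → Node I d → Set where
  hang     : ∀ {r} → Linked apex (node r hook)
  hook-far : ∀ {r i} → Linked (node r hook) (node r (far i))
  near-far : ∀ {r i j} → Linked (node r (near i)) (node r (far j))

Adjacent : ∀ {I d} → Node I d → Node I d → Set
Adjacent c c' = Linked c c' ⊎ Linked c' c

Broom : ℕ → Set
Broom δ = Fin δ ⊎ Fin δ

module _ (G : Graph) where

  T-coord : ∀ {δ} → TV G δ → Node (Broom δ) δ
  T-coord root     = apex
  T-coord (b1 j)   = node (inj₁ j) hook
  T-coord (l1 j k) = node (inj₁ j) (far k)
  T-coord (c2 j)   = node (inj₂ j) hook
  T-coord (b2 j)   = node (inj₂ j) (far j)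
  T-coord (l2 j k) = node (inj₂ j) (near k)

  -- Nodes outside the image of T-coord are sent to a vertex with the same neighbours
  -- in the image, so that T-decode is still a homomorphism.
  T-decode : ∀ {δ} → Node (Broom δ) δ → TV G δ
  T-decode apex                     = root
  T-decode (node (inj₁ j) hook)     = b1 j
  T-decode (node (inj₁ j) (near _)) = b1 j
  T-decode (node (inj₁ j) (far k))  = l1 j k
  T-decode (node (inj₂ j) hook)     = c2 j
  T-decode (node (inj₂ j) (near k)) = l2 j k
  T-decode (node (inj₂ j) (far _))  = b2 j

  T-decode∘T-coord : ∀ {δ} (x : TV G δ) → T-decode (T-coord x) ≡ x
  T-decode∘T-coord root     = refl
  T-decode∘T-coord (b1 j)   = refl
  T-decode∘T-coord (l1 j k) = refl
  T-decode∘T-coord (c2 j)   = refl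
  T-decode∘T-coord (b2 j)   = refl
  T-decode∘T-coord (l2 j k) = refl

  T-coord-linked : ∀ {δ} {x y : TV G δ} → TE0 G x y → Adjacent (T-coord x) (T-coord y)
  T-coord-linked (e-rb1 j)   = inj₁ hang
  T-coord-linked (e-b1l j k) = inj₁ hook-far
  T-coord-linked (e-rc2 j)   = inj₁ hang
  T-coord-linked (e-c2b j)   = inj₁ hook-far
  T-coord-linked (e-b2l j k) = inj₂ near-far

  T-coord-hom : ∀ {δ} {x y : TV G δ} → TE G x y → Adjacent (T-coord x) (T-coord y)
  T-coord-hom (inj₁ e) = T-coord-linked e
  T-coord-hom (inj₂ e) = swap (T-coord-linked e)

  T-decode-linked : ∀ {δ} {c c' : Node (Broom δ) δ} → Linked c c' → TE G (T-decode c) (T-decode c')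
  T-decode-linked {c' = node (inj₁ j) _}       hang     = inj₁ (e-rb1 j)
  T-decode-linked {c' = node (inj₂ j) _}       hang     = inj₁ (e-rc2 j)
  T-decode-linked {c' = node (inj₁ j) (far k)} hook-far = inj₁ (e-b1l j k)
  T-decode-linked {c' = node (inj₂ j) _}       hook-far = inj₁ (e-c2b j)
  T-decode-linked {c' = node (inj₁ j) (far k)} near-far = inj₁ (e-b1l j k)
  T-decode-linked {c  = node (inj₂ j) (near k)} near-far = inj₂ (e-b2l j k)

  T-decode-hom : ∀ {δ} {c c' : Node (Broom δ) δ} → Adjacent c c' → TE G (T-decode c) (T-decode c')
  T-decode-hom (inj₁ l) = T-decode-linked l
  T-decode-hom (inj₂ l) = swap (T-decode-linked l)

  T-coord-isInducedEmbedding : ∀ {δ} → IsInducedEmbedding (TE G) (Adjacent {Broom δ} {δ}) T-coord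
  T-coord-isInducedEmbedding =
    retract⇒isInducedEmbedding T-coord T-decode T-coord-hom T-decode-hom T-decode∘T-coord

  E-sym : ∀ {x y} → E G x y → E G y x
  E-sym {x} {y} e = trans (Graph.sym G y x) e

  E-irrefl : ∀ {x} → ¬ E G x x
  E-irrefl {x} e with () ← trans (sym e) (Graph.irref G x)

  core-parts-differ : ∀ {ζ β} (Y : Core G ζ β) {j j' k k'} → E G (Core.pt Y j k) (Core.pt Y j' k') → j ≢ j'
  core-parts-differ Y {j} {k = k} {k'} e refl = Core.stable Y j k k' e

  module SkeletonInG {I : Set} {d ζ b : ℕ} (v : V G) (Y : I → Core G ζ (suc (suc b)))
    (disjoint  : ∀ {r s p q p' q'} → Core.pt (Y r) p q ≡ Core.pt (Y s) p' q' → r ≡ s)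
    (separated : ∀ {r s p q p' q'} → E G (Core.pt (Y r) p q) (Core.pt (Y s) p' q') → r ≡ s)
    (v∉Y       : ∀ r → ¬ InCore G (Y r) v)
    (touching  : ∀ r → HasNbrIn G (Y r) v)
    (sparse    : ∀ r p → Selection (Fin d) (λ q → ¬ E G v (Core.pt (Y r) p q)))
    where

    hookPart farPart : I → Fin (suc (suc b))
    hookPart r = proj₁ (touching r)
    farPart r  = punchIn (hookPart r) zero

    farPart≢hookPart : ∀ r → farPart r ≢ hookPart r
    farPart≢hookPart r = punchInᵢ≢i (hookPart r) zero

    nonNbr : I → Fin (suc (suc b)) → Fin d → Fin ζ
    nonNbr r p = proj₁ (sparse r p)

    part : I → Slot d → Fin (suc (suc b))
    part r hook     = hookPart r
    part r (near _) = hookPart r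
    part r (far _)  = farPart r

    element : (r : I) → Slot d → Fin ζ
    element r hook     = proj₁ (proj₂ (touching r))
    element r (near i) = nonNbr r (hookPart r) i
    element r (far i)  = nonNbr r (farPart r) i

    embed : Node I d → V G
    embed apex       = v
    embed (node r s) = Core.pt (Y r) (part r s) (element r s)

    hook-nbr : ∀ r → E G v (embed (node r hook))
    hook-nbr r = proj₂ (proj₂ (touching r))

    nonNbr-nonadjacent : ∀ r p i → ¬ E G v (Core.pt (Y r) p (nonNbr r p i))
    nonNbr-nonadjacent r p = proj₂ (proj₂ (sparse r p))

    nonNbr-injective : ∀ r p {i j} → nonNbr r p i ≡ nonNbr r p j → i ≡ j
    nonNbr-injective r p = proj₁ (proj₂ (sparse r p))

    hook≢near : ∀ r i → element r hook ≢ element r (near i)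
    hook≢near r i e = nonNbr-nonadjacent r (hookPart r) i (subst (E G v ∘ Core.pt (Y r) (hookPart r)) e (hook-nbr r))

    position-injective : ∀ r s s' → part r s ≡ part r s' × element r s ≡ element r s' → s ≡ s'
    position-injective r hook     hook     _       = refl
    position-injective r hook     (near i) (_ , e) = ⊥-elim (hook≢near r i e)
    position-injective r (near i) hook     (_ , e) = ⊥-elim (hook≢near r i (sym e))
    position-injective r (near i) (near j) (_ , e) = cong near (nonNbr-injective r _ e)
    position-injective r (far i)  (far j)  (_ , e) = cong far (nonNbr-injective r _ e)
    position-injective r hook     (far _)  (p , _) = ⊥-elim (farPart≢hookPart r (sym p))
    position-injective r (near _) (far _)  (p , _) = ⊥-elim (farPart≢hookPart r (sym p))
    position-injective r (far _)  hook     (p , _) = ⊥-elim (farPart≢hookPart r p)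
    position-injective r (far _)  (near _) (p , _) = ⊥-elim (farPart≢hookPart r p)

    embed-injective : ∀ c c' → embed c ≡ embed c' → c ≡ c'
    embed-injective apex       apex        _ = refl
    embed-injective apex       (node r s)  e = ⊥-elim (v∉Y r (part r s , element r s , sym e))
    embed-injective (node r s) apex        e = ⊥-elim (v∉Y r (part r s , element r s , e))
    embed-injective (node r s) (node r' s') e with refl ← disjoint e =
      cong (node r) (position-injective r s s' (Core.inj (Y r) _ _ _ _ e))

    apex-reflects : ∀ c → E G v (embed c) → Adjacent apex c
    apex-reflects apex              e = ⊥-elim (E-irrefl e)
    apex-reflects (node r hook)     _ = inj₁ hang
    apex-reflects (node r (near i)) e = ⊥-elim (nonNbr-nonadjacent r _ i e)
    apex-reflects (node r (far i))  e = ⊥-elim (nonNbr-nonadjacent r _ i e)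

    parts-apart : ∀ r s s' → part r s ≢ part r s' → Adjacent (node r s) (node r s')
    parts-apart r hook     (far _)  _ = inj₁ hook-far
    parts-apart r (near _) (far _)  _ = inj₁ near-far
    parts-apart r (far _)  hook     _ = inj₂ hook-far
    parts-apart r (far _)  (near _) _ = inj₂ near-far
    parts-apart r hook     hook     p = ⊥-elim (p refl)
    parts-apart r hook     (near _) p = ⊥-elim (p refl)
    parts-apart r (near _) hook     p = ⊥-elim (p refl)
    parts-apart r (near _) (near _) p = ⊥-elim (p refl)
    parts-apart r (far _)  (far _)  p = ⊥-elim (p refl)

    embed-reflects : ∀ c c' → E G (embed c) (embed c') → Adjacent c c'
    embed-reflects apex        c'          e = apex-reflects c' e
    embed-reflects (node r s)  apex        e = swap (apex-reflects (node r s) (E-sym e))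
    embed-reflects (node r s) (node r' s') e with refl ← separated e = parts-apart r s s' (core-parts-differ (Y r) e)

    embed-linked : ∀ {c c'} → Linked c c' → E G (embed c) (embed c')
    embed-linked {c' = node r _} hang     = hook-nbr r
    embed-linked {c = node r _}  hook-far = Core.complete (Y r) _ _ _ _ (farPart≢hookPart r ∘ sym)
    embed-linked {c = node r _}  near-far = Core.complete (Y r) _ _ _ _ (farPart≢hookPart r ∘ sym)

    embed-preserves : ∀ {c c'} → Adjacent c c' → E G (embed c) (embed c')
    embed-preserves (inj₁ l) = embed-linked l
    embed-preserves (inj₂ l) = E-sym (embed-linked l)

    embed-isInducedEmbedding : IsInducedEmbedding Adjacent (E G) embed
    embed-isInducedEmbedding = embed-injective , λ c c' → embed-reflects c c' , embed-preserves

module _ {G : Graph} {α ζ β η : ℕ} (T : TemplateArray G α ζ β η) where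
  open TemplateArray T

  cores-disjoint : ∀ {i i' p q p' q'} → Core.pt (Y i) p q ≡ Core.pt (Y i') p' q' → i ≡ i'
  cores-disjoint {i} {i'} {p} {q} {p'} {q'} e with <-cmp i i'
  ... | tri< i<i' _ _ = ⊥-elim (disj i i' i<i' _ (Y⊆H i p q) (subst (H i') (sym e) (Y⊆H i' p' q')))
  ... | tri≈ _ i≡i' _ = i≡i'
  ... | tri> _ _ i'<i = ⊥-elim (disj i' i i'<i _ (Y⊆H i' p' q') (subst (H i) e (Y⊆H i p q)))

  cores-separated : ∀ {i i' p q p' q'} → E G (Core.pt (Y i) p q) (Core.pt (Y i') p' q') → i ≡ i'
  cores-separated {i} {i'} {p} {q} {p'} {q'} e with <-cmp i i'
  ... | tri< i<i' _ _ = ⊥-elim (noEdge i i' i<i' _ _ (Y⊆H i p q) (p' , q' , refl) e)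
  ... | tri≈ _ i≡i' _ = i≡i'
  ... | tri> _ _ i'<i = ⊥-elim (noEdge i' i i'<i _ _ (Y⊆H i' p' q') (p , q , refl) (E-sym G e))

  home : ∀ {v} → VT v → Maybe (Fin n)
  home (inj₁ (k , _)) = just k
  home (inj₂ _)       = nothing

  away-from-home : ∀ {v} (w : VT v) i → HasNbrIn G (Y i) v → just i ≢ home w →
                   ¬ InCore G (Y i) v × ¬ Mixed G α η v (Y i)
  away-from-home {v} (inj₁ (k , v∈Hk)) i (p , q , e) i≢k with <-cmp i k
  ... | tri< i<k _ _ =
    (λ { (p' , q' , refl) → disj i k i<k v (Y⊆H i p' q') v∈Hk }) , noMix i k i<k v v∈Hk
  ... | tri≈ _ i≡k _ = ⊥-elim (i≢k (cong just i≡k))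
  ... | tri> _ _ k<i = ⊥-elim (noEdge k i k<i v _ v∈Hk (p , q , refl) e)
  away-from-home (inj₂ v∈U) i _ _ =
    (λ { (p , q , refl) → U∉H _ v∈U i (Y⊆H i p q) }) , UnoMix _ v∈U i

fewer-than-η-neighbours : ∀ {G α ζ β η v} {Y : Core G ζ β} →
                          ¬ Mixed G α η v Y → ¬ Dense G α v Y → ∀ j → nbrsInPart G Y v j < η
fewer-than-η-neighbours {G} {η = η} {v} {Y} ¬mixed ¬dense j with η ≤? nbrsInPart G Y v j
... | yes η≤ = ⊥-elim (¬mixed (¬dense , j , η≤))
... | no η≰  = ≰⇒> η≰

non-neighbours : ∀ {G ζ β δ v} (Y : Core G ζ β) j → nbrsInPart G Y v j + δ ≤ ζ →
                 Selection (Fin δ) (λ q → ¬ E G v (Core.pt Y j q))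
non-neighbours {G} {ζ} {δ = δ} {v} Y j bound =
  selection-map (λ {q} q∈∁t e → x∈∁p⇒x∉p q∈∁t (lookup⇒[]= q t (trans (lookup∘tabulate _ q) e)))
                (select (∁ t) δ≤∣∁t∣)
  where
  t : Subset ζ
  t = tabulate (λ k → Graph.adj G v (Core.pt Y j k))

  δ≤∣∁t∣ : δ ≤ ∣ ∁ t ∣
  δ≤∣∁t∣ = subst (δ ≤_) (sym (∣∁p∣≡n∸∣p∣ t)) (m+n≤o⇒m≤o∸n δ (subst (_≤ ζ) (+-comm ∣ t ∣ δ) bound))

touched-cores⇒induced-T : ∀ {G α ζ b η δ} (T : TemplateArray G α ζ (suc (suc b)) η) →
                          TemplateArray.OneCleaned T → η + δ ≤ ζ →
                          ∀ {v} → TemplateArray.VT T v → (S : Subset (TemplateArray.n T)) →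
                          (∀ i → i ∈ S → HasNbrIn G (TemplateArray.Y T i) v) → 2 * δ < ∣ S ∣ →
                          HasInducedT G δ
touched-cores⇒induced-T {G} {α} {ζ} {b} {η} {δ} T cleaned η+δ≤ζ {v} w S touching 2δ<∣S∣ =
  Skeleton.embed ∘ T-coord G ,
  isInducedEmbedding-∘ {U = E G} (T-coord-isInducedEmbedding G) Skeleton.embed-isInducedEmbedding
  where
  open TemplateArray T using (Y)

  2δ+1≤∣S∣ : suc (δ + δ) ≤ ∣ S ∣
  2δ+1≤∣S∣ = subst (λ m → suc (δ + m) ≤ ∣ S ∣) (+-identityʳ δ) 2δ<∣S∣

  chosen : Selection (Broom δ) (λ i → i ∈ S × just i ≢ home T w)
  chosen = selection-reindex {P = λ i → i ∈ S × just i ≢ home T w} (join δ δ) (join-injective δ δ)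
             (selection-avoid {P = _∈ S} (select S 2δ+1≤∣S∣) (home T w))

  Y' : Broom δ → Core G ζ (suc (suc b))
  Y' = Y ∘ proj₁ chosen

  chosen-injective : Injective _≡_ _≡_ (proj₁ chosen)
  chosen-injective = proj₁ (proj₂ chosen)

  chosen∈S : ∀ r → proj₁ chosen r ∈ S
  chosen∈S r = proj₁ (proj₂ (proj₂ chosen) r)

  chosen≢home : ∀ r → just (proj₁ chosen r) ≢ home T w
  chosen≢home r = proj₂ (proj₂ (proj₂ chosen) r)

  away : ∀ r → ¬ InCore G (Y' r) v × ¬ Mixed G α η v (Y' r)
  away r = away-from-home T w _ (touching _ (chosen∈S r)) (chosen≢home r)

  v∉Y' : ∀ r → ¬ InCore G (Y' r) v
  v∉Y' = proj₁ ∘ away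

  few-neighbours : ∀ r p → nbrsInPart G (Y' r) v p < η
  few-neighbours r = fewer-than-η-neighbours {G} {α} {η = η} {v} {Y' r} (proj₂ (away r)) (cleaned _ v w)

  sparse : ∀ r p → Selection (Fin δ) (λ q → ¬ E G v (Core.pt (Y' r) p q))
  sparse r p = non-neighbours {G} (Y' r) p (≤-trans (+-monoˡ-≤ δ (<⇒≤ (few-neighbours r p))) η+δ≤ζ)

  module Skeleton = SkeletonInG G v Y' (chosen-injective ∘ cores-disjoint T) (chosen-injective ∘ cores-separated T)
                                       v∉Y' (touching _ ∘ chosen∈S) sparse

mainTheorem9 : (τ α δ β : ℕ) (θ : ℕ → ℕ) → 1 ≤ α → 1 ≤ δ → 2 ≤ β
    → (∀ m n → m ≤ n → θ m ≤ θ n)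
    → (η ζ : ℕ) → 1 ≤ η → (η + δ) ⊔ α ≤ ζ
    → (G : Graph) → Conditions G τ α δ β θ
    → (T : TemplateArray G α ζ β η) → TemplateArray.OneCleaned T
    → ∀ v → TemplateArray.VT T v
    → (S : Subset (TemplateArray.n T))
    → (∀ i → i ∈ S → HasNbrIn G (TemplateArray.Y T i) v)
    → ∣ S ∣ ≤ 2 * δ
mainTheorem9 τ α δ (suc (suc b)) θ _ _ (s≤s (s≤s _)) _ η ζ _ ζ-large G conditions T cleaned v w S touching
  with ∣ S ∣ ≤? 2 * δ
... | yes ∣S∣≤2δ = ∣S∣≤2δ
... | no ∣S∣≰2δ  = ⊥-elim (Conditions.c1 conditions
        (touched-cores⇒induced-T T cleaned (≤-trans (m≤m⊔n (η + δ) α) ζ-large) w S touching (≰⇒> ∣S∣≰2δ)))
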